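{- Let $t>2$ be an even natural number, $n=2t+1$, and let $i$ be a natural number with $\gcd(i,n)=1$. Then the even Niho exponent $2^t+2^{t/2}-1$ is never cyclotomic equivalent to $e((t+2)/2,i)$ over $\mathbb{F}_{2^n}$.
   Context: For natural numbers $l,k$, $e(l,k)=\sum_{j=0}^{l-1}2^{jk}$. Two exponents $d,e$ are cyclotomic equivalent over $\mathbb{F}_{2^n}$ if there is a natural number $a$ with $2^a d\equiv e\pmod{2^n-1}$, or (when $\gcd(d,2^n-1)=1$) $2^a d^{ -1}\equiv e\pmod{2^n-1}$, where $d^{ -1}$ is the inverse of $d$ modulo $2^n-1$. -}

module Defs where

open import Data.Nat using (ℕ; zero; suc; _+_; _*_; _∸_; _^_)
open import Data.Nat.GCD using (gcd)
open import Data.Product using (∃; ∃-syntax; _×_)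
open import Data.Sum using (_⊎_)
open import Relation.Binary.PropositionalEquality using (_≡_)

e : ℕ → ℕ → ℕ
e zero    k = 0
e (suc l) k = e l k + 2 ^ (l * k)

infix 4 _≡_[mod_]
_≡_[mod_] : ℕ → ℕ → ℕ → Set
a ≡ b [mod N ] = ∃[ x ] ∃[ y ] (a + x * N ≡ b + y * N)

CycEquiv : ℕ → ℕ → ℕ → Set
CycEquiv n d e′ =
  (∃[ a ] ((2 ^ a * d) ≡ e′ [mod (2 ^ n ∸ 1) ]))
  ⊎ ((gcd d (2 ^ n ∸ 1) ≡ 1) ×
     ∃[ dinv ] (((d * dinv) ≡ 1 [mod (2 ^ n ∸ 1) ]) ×
                ∃[ a ] ((2 ^ a * dinv) ≡ e′ [mod (2 ^ n ∸ 1) ])))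

module Submission where

-- Write t = 2M, n = 4M + 1, D = 2^{2M} + 2^M − 1 and E = e(M + 1, i).  Since 2^i E + 1 = E + 2^{(M+1)i},
-- either kind of cyclotomic equivalence becomes, after cancelling a power of 2 and reducing exponents
-- modulo n, a congruence 2^u (D + 2^z) ≡ D + 2^v (mod 2^n − 1) with 0 < u < n; coprimality of i and n
-- is what rules out n ∣ u.  Both sides are reduced residues, so the n binary digits of D + 2^v are those
-- of D + 2^z rotated by u places.  According to where the carry in D + 2^z stops there are three digit
-- patterns; patterns of different weight are never rotations of each other, and for equal weights a
-- case analysis on u finds a digit 1 that the rotation moves onto a digit 0.

open import Defs
open import Data.Bool using (Bool; true; false; _∨_; T)
open import Data.Bool.Properties using (T-∨)
open import Data.Empty using (⊥; ⊥-elim)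
open import Data.List using ([]; _∷_)
open import Data.Nat
open import Data.Nat.Coprimality using (coprime-divisor; gcd≡1⇒coprime)
import Data.Nat.Coprimality as Coprimality
open import Data.Nat.Divisibility using (_∣_; divides; ∣-refl; ∣1⇒≡1; ∣⇒≤; m%n≡0⇒n∣m)
open import Data.Nat.DivMod
open import Data.Nat.GCD using (gcd; gcd-greatest)
open import Data.Nat.Properties
open import Algebra.Properties.CommutativeSemigroup *-commutativeSemigroup using (x∙yz≈y∙xz)
open import Data.Nat.Tactic.RingSolver using (solve)
open import Data.Product using (∃-syntax; _×_; _,_; proj₁; proj₂)
open import Data.Sum using (_⊎_; inj₁; inj₂)
open import Function.Base using (_∘_)
open import Function.Bundles using (Equivalence)
open import Relation.Binary.Bundles using (Setoid)
open import Relation.Binary.Definitions using (tri<; tri≈; tri>)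
open import Relation.Binary.PropositionalEquality
import Relation.Binary.Reasoning.Setoid as SetoidReasoning
open import Relation.Nullary using (¬_; yes; no)

[m%n+k]%n≡[m+k]%n : ∀ m k n .{{_ : NonZero n}} → (m % n + k) % n ≡ (m + k) % n
[m%n+k]%n≡[m+k]%n m k n = begin
  (m % n + k) % n         ≡⟨ %-distribˡ-+ (m % n) k n ⟩
  (m % n % n + k % n) % n ≡⟨ cong (λ r → (r + k % n) % n) (m%n%n≡m%n m n) ⟩
  (m % n + k % n) % n     ≡⟨ %-distribˡ-+ m k n ⟨
  (m + k) % n             ∎
  where open ≡-Reasoning

≤-by : ∀ {a b} c → a + c ≡ b → a ≤ b
≤-by {a} c refl = m≤m+n a c

-- a ≤ b from x ≤ y once a + y + c ≡ b + x is a ring identity, which solve can check.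
≤-via : ∀ {a b x y} c → x ≤ y → a + y + c ≡ b + x → a ≤ b
≤-via {a} {b} {x} {y} c x≤y eq = +-cancelʳ-≤ x a b (begin
  a + x     ≤⟨ +-monoʳ-≤ a x≤y ⟩
  a + y     ≤⟨ m≤m+n (a + y) c ⟩
  a + y + c ≡⟨ eq ⟩
  b + x     ∎)
  where open ≤-Reasoning

≡-via : ∀ {a b x y} → x ≡ y → a + y ≡ b + x → a ≡ b
≡-via {a} {b} {x} refl eq = +-cancelʳ-≡ x a b eq

module Congruence (N : ℕ) where

  infix 4 _≋_
  _≋_ : ℕ → ℕ → Set
  a ≋ b = a ≡ b [mod N ]

  ≋-refl : ∀ {a} → a ≋ a
  ≋-refl = 0 , 0 , refl

  ≋-sym : ∀ {a b} → a ≋ b → b ≋ a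
  ≋-sym (x , y , p) = y , x , sym p

  ≋-trans : ∀ {a b c} → a ≋ b → b ≋ c → a ≋ c
  ≋-trans {a} {b} {c} (x , y , p) (x′ , y′ , q) = x + x′ , y′ + y , (begin
    a + (x + x′) * N     ≡⟨ solve (a ∷ x ∷ x′ ∷ N ∷ []) ⟩
    (a + x * N) + x′ * N ≡⟨ cong (_+ x′ * N) p ⟩
    (b + y * N) + x′ * N ≡⟨ solve (b ∷ y ∷ x′ ∷ N ∷ []) ⟩
    (b + x′ * N) + y * N ≡⟨ cong (_+ y * N) q ⟩
    (c + y′ * N) + y * N ≡⟨ solve (c ∷ y ∷ y′ ∷ N ∷ []) ⟩
    c + (y′ + y) * N     ∎)
    where open ≡-Reasoning

  ≋-setoid : Setoid _ _
  ≋-setoid = record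
    { Carrier = ℕ ; _≈_ = _≋_
    ; isEquivalence = record { refl = ≋-refl ; sym = ≋-sym ; trans = ≋-trans } }

  module ≋-Reasoning = SetoidReasoning ≋-setoid

  ≡⇒≋ : ∀ {a b} → a ≡ b → a ≋ b
  ≡⇒≋ refl = ≋-refl

  +-cong : ∀ {a b c d} → a ≋ b → c ≋ d → a + c ≋ b + d
  +-cong {a} {b} {c} {d} (x , y , p) (x′ , y′ , q) = x + x′ , y + y′ , (begin
    a + c + (x + x′) * N       ≡⟨ solve (a ∷ c ∷ x ∷ x′ ∷ N ∷ []) ⟩
    (a + x * N) + (c + x′ * N) ≡⟨ cong₂ _+_ p q ⟩
    (b + y * N) + (d + y′ * N) ≡⟨ solve (b ∷ d ∷ y ∷ y′ ∷ N ∷ []) ⟩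
    b + d + (y + y′) * N       ∎)
    where open ≡-Reasoning

  +-congˡ : ∀ c {a b} → a ≋ b → c + a ≋ c + b
  +-congˡ c = +-cong (≋-refl {c})

  +-congʳ : ∀ c {a b} → a ≋ b → a + c ≋ b + c
  +-congʳ c h = +-cong h (≋-refl {c})

  *-congˡ : ∀ c {a b} → a ≋ b → c * a ≋ c * b
  *-congˡ c {a} {b} (x , y , p) = c * x , c * y , (begin
    c * a + c * x * N ≡⟨ solve (c ∷ a ∷ x ∷ N ∷ []) ⟩
    c * (a + x * N)   ≡⟨ cong (c *_) p ⟩
    c * (b + y * N)   ≡⟨ solve (c ∷ b ∷ y ∷ N ∷ []) ⟩
    c * b + c * y * N ∎)
    where open ≡-Reasoning

  *-congʳ : ∀ c {a b} → a ≋ b → a * c ≋ b * c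
  *-congʳ c {a} {b} h = subst₂ _≋_ (*-comm c a) (*-comm c b) (*-congˡ c h)

  ≋⇒%≡ : ∀ {a b} .{{_ : NonZero N}} → a ≋ b → a % N ≡ b % N
  ≋⇒%≡ {a} {b} (x , y , p) = begin
    a % N           ≡⟨ [m+kn]%n≡m%n a x N ⟨
    (a + x * N) % N ≡⟨ cong (_% N) p ⟩
    (b + y * N) % N ≡⟨ [m+kn]%n≡m%n b y N ⟩
    b % N           ∎
    where open ≡-Reasoning

  -- The residues 1, …, N − 1 are represented by themselves and 0 also by N.
  ≋⇒≡ : ∀ {a b} → a ≤ N → 0 < b → b < N → a ≋ b → a ≡ b
  ≋⇒≡ {a} {b} a≤N 0<b b<N a≋b with m≤n⇒m<n∨m≡n a≤N
  ... | inj₁ a<N = begin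
    a     ≡⟨ m<n⇒m%n≡m a<N ⟨
    a % N ≡⟨ ≋⇒%≡ a≋b ⟩
    b % N ≡⟨ m<n⇒m%n≡m b<N ⟩
    b     ∎
    where instance _ = >-nonZero (<-trans 0<b b<N)
          open ≡-Reasoning
  ... | inj₂ refl = ⊥-elim (<⇒≢ 0<b (begin
    0     ≡⟨ n%n≡0 N ⟨
    N % N ≡⟨ ≋⇒%≡ a≋b ⟩
    b % N ≡⟨ m<n⇒m%n≡m b<N ⟩
    b     ∎))
    where instance _ = >-nonZero (<-trans 0<b b<N)
          open ≡-Reasoning

Bits : Set
Bits = ℕ → Bool

infix 4 _∈_ _∉_
_∈_ : ℕ → Bits → Set
j ∈ X = T (X j)

_∉_ : ℕ → Bits → Set
j ∉ X = ¬ j ∈ X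

infixr 6 _∪_
_∪_ : Bits → Bits → Bits
(X ∪ Y) j = X j ∨ Y j

below : ℕ → Bits
below l j = j <ᵇ l

⁅_⁆ : ℕ → Bits
⁅ i ⁆ j = j ≡ᵇ i

Disjoint : Bits → Bits → Set
Disjoint X Y = ∀ j → j ∈ X → j ∉ Y

module _ {j : ℕ} where

  ∈-below : ∀ {l} → j < l → j ∈ below l
  ∈-below = <⇒<ᵇ

  ∈-below⁻ : ∀ {l} → j ∈ below l → j < l
  ∈-below⁻ {l} = <ᵇ⇒< j l

  ∉-below : ∀ {l} → l ≤ j → j ∉ below l
  ∉-below l≤j j∈ = <⇒≱ (∈-below⁻ j∈) l≤j

  ∈-⁅⁆ : j ∈ ⁅ j ⁆
  ∈-⁅⁆ = ≡⇒≡ᵇ j j refl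

  ∈-⁅⁆⁻ : ∀ {i} → j ∈ ⁅ i ⁆ → j ≡ i
  ∈-⁅⁆⁻ {i} = ≡ᵇ⇒≡ j i

  ∉-⁅⁆ : ∀ {i} → j ≢ i → j ∉ ⁅ i ⁆
  ∉-⁅⁆ j≢i j∈ = j≢i (∈-⁅⁆⁻ j∈)

  ∈-∪ˡ : ∀ {X} Y → j ∈ X → j ∈ X ∪ Y
  ∈-∪ˡ {X} Y j∈X = Equivalence.from (T-∨ {X j} {Y j}) (inj₁ j∈X)

  ∈-∪ʳ : ∀ X {Y} → j ∈ Y → j ∈ X ∪ Y
  ∈-∪ʳ X {Y} j∈Y = Equivalence.from (T-∨ {X j} {Y j}) (inj₂ j∈Y)

  ∈-∪⁻ : ∀ X Y → j ∈ X ∪ Y → j ∈ X ⊎ j ∈ Y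
  ∈-∪⁻ X Y = Equivalence.to (T-∨ {X j} {Y j})

  ∉-∪ : ∀ {X Y} → j ∉ X → j ∉ Y → j ∉ X ∪ Y
  ∉-∪ {X} {Y} j∉X j∉Y j∈ with ∈-∪⁻ X Y j∈
  ... | inj₁ j∈X = j∉X j∈X
  ... | inj₂ j∈Y = j∉Y j∈Y

below-⁅⁆-disjoint : ∀ {l i} → l ≤ i → Disjoint (below l) ⁅ i ⁆
below-⁅⁆-disjoint {l} {i} l≤i j j∈ = ∉-⁅⁆ {j} {i} (<⇒≢ (<-≤-trans (∈-below⁻ {j} {l} j∈) l≤i))

⁅⁆-disjoint : ∀ {i i′} → i ≢ i′ → Disjoint ⁅ i ⁆ ⁅ i′ ⁆
⁅⁆-disjoint {i} {i′} i≢i′ j j∈ = ∉-⁅⁆ {j} {i′} (λ j≡i′ → i≢i′ (trans (sym (∈-⁅⁆⁻ {j} {i} j∈)) j≡i′))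

∪-disjointˡ : ∀ {X Y Z} → Disjoint X Z → Disjoint Y Z → Disjoint (X ∪ Y) Z
∪-disjointˡ {X} {Y} X∩Z=∅ Y∩Z=∅ j j∈ with ∈-∪⁻ X Y j∈
... | inj₁ j∈X = X∩Z=∅ j j∈X
... | inj₂ j∈Y = Y∩Z=∅ j j∈Y

∪-disjointʳ : ∀ {X Y Z} → Disjoint X Y → Disjoint X Z → Disjoint X (Y ∪ Z)
∪-disjointʳ {X} {Y} {Z} X∩Y=∅ X∩Z=∅ j j∈X = ∉-∪ {j} {Y} {Z} (X∩Y=∅ j j∈X) (X∩Z=∅ j j∈X)

bit : Bool → ℕ
bit true  = 1
bit false = 0

-- eval b n X = Σ_{j < n, j ∈ X} b ^ j: the number with binary digits X for b = 2, the size of X below n for b = 1.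
eval : ℕ → ℕ → Bits → ℕ
eval b zero    X = 0
eval b (suc n) X = bit (X 0) + b * eval b n (X ∘ suc)

geo : ℕ → ℕ → ℕ
geo b zero    = 0
geo b (suc l) = 1 + b * geo b l

eval-cong : ∀ b n {X Y} → (∀ {j} → j < n → X j ≡ Y j) → eval b n X ≡ eval b n Y
eval-cong b zero    X≗Y = refl
eval-cong b (suc n) X≗Y =
  cong₂ (λ x y → bit x + b * y) (X≗Y z<s) (eval-cong b n (λ j<n → X≗Y (s<s j<n)))

eval-last : ∀ b n X → eval b (suc n) X ≡ eval b n X + bit (X n) * b ^ n
eval-last b zero X = begin
  bit (X 0) + b * 0 ≡⟨ cong (bit (X 0) +_) (*-zeroʳ b) ⟩
  bit (X 0) + 0     ≡⟨ +-identityʳ (bit (X 0)) ⟩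
  bit (X 0)         ≡⟨ *-identityʳ (bit (X 0)) ⟨
  bit (X 0) * 1     ∎
  where open ≡-Reasoning
eval-last b (suc n) X = begin
  bit (X 0) + b * eval b (suc n) X′                       ≡⟨ cong (λ v → bit (X 0) + b * v) (eval-last b n X′) ⟩
  bit (X 0) + b * (eval b n X′ + bit (X′ n) * b ^ n)      ≡⟨ rearrange (bit (X 0)) (eval b n X′) (bit (X′ n)) (b ^ n) ⟩
  bit (X 0) + b * eval b n X′ + bit (X′ n) * (b * b ^ n)  ∎
  where open ≡-Reasoning
        X′ : Bits
        X′ = X ∘ suc
        rearrange : ∀ x v y p → x + b * (v + y * p) ≡ x + b * v + y * (b * p)
        rearrange x v y p = solve (x ∷ b ∷ v ∷ y ∷ p ∷ [])

eval-∪ : ∀ b n X Y → Disjoint X Y → eval b n (X ∪ Y) ≡ eval b n X + eval b n Y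
eval-∪ b zero    X Y X∩Y=∅ = refl
eval-∪ b (suc n) X Y X∩Y=∅ = begin
  bit (X 0 ∨ Y 0) + b * eval b n (X′ ∪ Y′)                 ≡⟨ cong₂ (λ x y → x + b * y)
                                                               (bit-∨ (X 0) (Y 0) (X∩Y=∅ 0)) (eval-∪ b n X′ Y′ (X∩Y=∅ ∘ suc)) ⟩
  bit (X 0) + bit (Y 0) + b * (eval b n X′ + eval b n Y′) ≡⟨ rearrange (bit (X 0)) (bit (Y 0)) (eval b n X′) (eval b n Y′) ⟩
  bit (X 0) + b * eval b n X′ + (bit (Y 0) + b * eval b n Y′) ∎
  where open ≡-Reasoning
        X′ : Bits
        X′ = X ∘ suc
        Y′ : Bits
        Y′ = Y ∘ suc
        bit-∨ : ∀ x y → (T x → ¬ T y) → bit (x ∨ y) ≡ bit x + bit y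
        bit-∨ true  true  x∩y=∅ = ⊥-elim (x∩y=∅ _ _)
        bit-∨ true  false _     = refl
        bit-∨ false _     _     = refl
        rearrange : ∀ x y v w → x + y + b * (v + w) ≡ x + b * v + (y + b * w)
        rearrange x y v w = solve (x ∷ y ∷ b ∷ v ∷ w ∷ [])

eval-below : ∀ b n {l} → l ≤ n → eval b n (below l) ≡ geo b l
eval-below b n       {zero}  _         = eval-∅ n
  where eval-∅ : ∀ n → eval b n (λ _ → false) ≡ 0
        eval-∅ zero    = refl
        eval-∅ (suc n) = trans (cong (b *_) (eval-∅ n)) (*-zeroʳ b)
eval-below b (suc n) {suc l} (s≤s l≤n) = cong (λ v → 1 + b * v) (eval-below b n l≤n)

eval-⁅⁆ : ∀ b n {i} → i < n → eval b n ⁅ i ⁆ ≡ b ^ i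
eval-⁅⁆ b (suc n) {zero}  _         = cong suc (trans (cong (b *_) (eval-below b n {0} z≤n)) (*-zeroʳ b))
eval-⁅⁆ b (suc n) {suc i} (s<s i<n) = cong (b *_) (eval-⁅⁆ b n i<n)

geo-2 : ∀ l → geo 2 l + 1 ≡ 2 ^ l
geo-2 zero    = refl
geo-2 (suc l) = begin
  1 + 2 * geo 2 l + 1 ≡⟨ cong suc (+-comm (2 * geo 2 l) 1) ⟩
  2 + 2 * geo 2 l     ≡⟨ *-distribˡ-+ 2 1 (geo 2 l) ⟨
  2 * (1 + geo 2 l)   ≡⟨ cong (2 *_) (+-comm 1 (geo 2 l)) ⟩
  2 * (geo 2 l + 1)   ≡⟨ cong (2 *_) (geo-2 l) ⟩
  2 * 2 ^ l           ∎
  where open ≡-Reasoning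

geo-1 : ∀ l → geo 1 l ≡ l
geo-1 zero    = refl
geo-1 (suc l) = cong suc (trans (+-identityʳ (geo 1 l)) (geo-1 l))

eval-<-2^ : ∀ n X → eval 2 n X < 2 ^ n
eval-<-2^ zero    X = z<s
eval-<-2^ (suc n) X = begin-strict
  bit (X 0) + 2 * eval 2 n X′ <⟨ +-monoˡ-< _ (bit<2 (X 0)) ⟩
  2 + 2 * eval 2 n X′         ≡⟨ *-distribˡ-+ 2 1 (eval 2 n X′) ⟨
  2 * suc (eval 2 n X′)       ≤⟨ *-monoʳ-≤ 2 (eval-<-2^ n X′) ⟩
  2 * 2 ^ n                   ∎
  where open ≤-Reasoning
        X′ : Bits
        X′ = X ∘ suc
        bit<2 : ∀ x → bit x < 2
        bit<2 true  = s<s z<s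
        bit<2 false = z<s

bit-+-2*-injective : ∀ x y {a b} → bit x + 2 * a ≡ bit y + 2 * b → x ≡ y × a ≡ b
bit-+-2*-injective true  true  {a} {b} p = refl , *-cancelˡ-≡ a b 2 (suc-injective p)
bit-+-2*-injective false false {a} {b} p = refl , *-cancelˡ-≡ a b 2 p
bit-+-2*-injective true  false {a} {b} p = ⊥-elim (even≢odd b a (sym p))
bit-+-2*-injective false true  {a} {b} p = ⊥-elim (even≢odd a b p)

eval-injective : ∀ n {X Y} → eval 2 n X ≡ eval 2 n Y → ∀ {j} → j < n → X j ≡ Y j
eval-injective (suc n) {X} {Y} X=Y {zero}  _         =
  proj₁ (bit-+-2*-injective (X 0) (Y 0) {eval 2 n (X ∘ suc)} {eval 2 n (Y ∘ suc)} X=Y)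
eval-injective (suc n) {X} {Y} X=Y {suc j} (s<s j<n) =
  eval-injective n (proj₂ (bit-+-2*-injective (X 0) (Y 0) {eval 2 n (X ∘ suc)} {eval 2 n (Y ∘ suc)} X=Y)) j<n

module Cyclic (n′ : ℕ) where

  n : ℕ
  n = suc n′

  N : ℕ
  N = 2 ^ n ∸ 1

  open Congruence N public

  2^n≡1+N : 2 ^ n ≡ 1 + N
  2^n≡1+N = sym (m+[n∸m]≡n (m^n>0 2 n))

  2^[q*n]≋1 : ∀ q → 2 ^ (q * n) ≋ 1
  2^[q*n]≋1 zero    = ≋-refl
  2^[q*n]≋1 (suc q) = begin
    2 ^ (n + q * n)     ≡⟨ ^-distribˡ-+-* 2 n (q * n) ⟩
    2 ^ n * 2 ^ (q * n) ≈⟨ *-congˡ (2 ^ n) (2^[q*n]≋1 q) ⟩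
    2 ^ n * 1           ≡⟨ trans (*-identityʳ (2 ^ n)) 2^n≡1+N ⟩
    1 + N               ≈⟨ 0 , 1 , trans (+-identityʳ (1 + N)) (cong suc (sym (+-identityʳ N))) ⟩
    1                   ∎
    where open ≋-Reasoning

  2^≋2^[%n] : ∀ a → 2 ^ a ≋ 2 ^ (a % n)
  2^≋2^[%n] a = begin
    2 ^ a                           ≡⟨ cong (2 ^_) (m≡m%n+[m/n]*n a n) ⟩
    2 ^ (a % n + a / n * n)         ≡⟨ ^-distribˡ-+-* 2 (a % n) (a / n * n) ⟩
    2 ^ (a % n) * 2 ^ (a / n * n)   ≈⟨ *-congˡ (2 ^ (a % n)) (2^[q*n]≋1 (a / n)) ⟩
    2 ^ (a % n) * 1                 ≡⟨ *-identityʳ (2 ^ (a % n)) ⟩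
    2 ^ (a % n)                     ∎
    where open ≋-Reasoning

  2^-cong : ∀ a b → a % n ≡ b % n → 2 ^ a ≋ 2 ^ b
  2^-cong a b a≡b = begin
    2 ^ a       ≈⟨ 2^≋2^[%n] a ⟩
    2 ^ (a % n) ≡⟨ cong (2 ^_) a≡b ⟩
    2 ^ (b % n) ≈⟨ 2^≋2^[%n] b ⟨
    2 ^ b       ∎
    where open ≋-Reasoning

  2^-cancel : ∀ c {a b} → 2 ^ c * a ≋ 2 ^ c * b → a ≋ b
  2^-cancel c {a} {b} h = begin
    a                         ≈⟨ unit a ⟨
    2 ^ (n′ * c) * (2 ^ c * a) ≈⟨ *-congˡ (2 ^ (n′ * c)) h ⟩
    2 ^ (n′ * c) * (2 ^ c * b) ≈⟨ unit b ⟩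
    b                         ∎
    where
      open ≋-Reasoning
      unit : ∀ x → 2 ^ (n′ * c) * (2 ^ c * x) ≋ x
      unit x = begin
        2 ^ (n′ * c) * (2 ^ c * x) ≡⟨ *-assoc (2 ^ (n′ * c)) (2 ^ c) x ⟨
        2 ^ (n′ * c) * 2 ^ c * x   ≡⟨ cong (_* x) (^-distribˡ-+-* 2 (n′ * c) c) ⟨
        2 ^ (n′ * c + c) * x       ≡⟨ cong (λ e → 2 ^ e * x) (trans (+-comm (n′ * c) c) (*-comm n c)) ⟩
        2 ^ (c * n) * x            ≈⟨ *-congʳ x (2^[q*n]≋1 c) ⟩
        1 * x                      ≡⟨ *-identityˡ x ⟩
        x                          ∎

  -- n′ * u ≡ − u (mod n), so rotate u X moves the digit at position j to position j + u (mod n).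
  rotate : ℕ → Bits → Bits
  rotate u X j = X ((j + n′ * u) % n)

  rotate₁ : Bits → Bits
  rotate₁ X j = X ((j + n′) % n)

  rotate-zero : ∀ X {j} → j < n → rotate 0 X j ≡ X j
  rotate-zero X {j} j<n = cong X (trans (cong (λ i → (j + i) % n) (*-zeroʳ n′))
                                        (trans (cong (_% n) (+-identityʳ j)) (m<n⇒m%n≡m j<n)))

  rotate-suc : ∀ u X j → rotate (suc u) X j ≡ rotate₁ (rotate u X) j
  rotate-suc u X j = cong X (begin
    (j + n′ * suc u) % n         ≡⟨ cong (λ i → (j + i) % n) (*-suc n′ u) ⟩
    (j + (n′ + n′ * u)) % n      ≡⟨ cong (_% n) (+-assoc j n′ (n′ * u)) ⟨
    (j + n′ + n′ * u) % n        ≡⟨ [m%n+k]%n≡[m+k]%n (j + n′) (n′ * u) n ⟨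
    ((j + n′) % n + n′ * u) % n  ∎)
    where open ≡-Reasoning

  rotate-at : ∀ u X {j} → j < n → rotate u X ((j + u) % n) ≡ X j
  rotate-at u X {j} j<n = cong X (begin
    ((j + u) % n + n′ * u) % n ≡⟨ [m%n+k]%n≡[m+k]%n (j + u) (n′ * u) n ⟩
    (j + u + n′ * u) % n       ≡⟨ cong (_% n) (trans (+-assoc j u (n′ * u)) (cong (j +_) (*-comm n u))) ⟩
    (j + u * n) % n            ≡⟨ [m+kn]%n≡m%n j u n ⟩
    j % n                      ≡⟨ m<n⇒m%n≡m j<n ⟩
    j                          ∎)
    where open ≡-Reasoning

  eval-rotate₁ : ∀ b X → eval b n (rotate₁ X) + bit (X n′) * b ^ n ≡ b * eval b n X + bit (X n′)
  eval-rotate₁ b X = begin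
    bit (X (n′ % n)) + b * eval b n′ (λ j → X ((suc j + n′) % n)) + x * (b * b ^ n′)
      ≡⟨ cong₂ (λ y v → bit y + b * v + x * (b * b ^ n′)) (cong X (m≤n⇒m%n≡m ≤-refl)) (eval-cong b n′ shifted) ⟩
    x + b * eval b n′ X + x * (b * b ^ n′)
      ≡⟨ rearrange x (eval b n′ X) (b ^ n′) ⟩
    b * (eval b n′ X + x * b ^ n′) + x
      ≡⟨ cong (λ v → b * v + x) (eval-last b n′ X) ⟨
    b * eval b n X + x
      ∎
    where
      open ≡-Reasoning
      x : ℕ
      x = bit (X n′)
      shifted : ∀ {j} → j < n′ → X ((suc j + n′) % n) ≡ X j
      shifted {j} j<n′ = cong X (trans (cong (_% n) (sym (+-suc j n′)))
                                       (trans ([m+n]%n≡m%n j n) (m<n⇒m%n≡m (m<n⇒m<1+n j<n′))))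
      rearrange : ∀ x v p → x + b * v + x * (b * p) ≡ b * (v + x * p) + x
      rearrange x v p = solve (x ∷ b ∷ v ∷ p ∷ [])

  eval₂-rotate₁ : ∀ X → eval 2 n (rotate₁ X) ≋ 2 * eval 2 n X
  eval₂-rotate₁ X = x , 0 , +-cancelʳ-≡ x _ _ (begin
    eval 2 n (rotate₁ X) + x * N + x   ≡⟨ regroup (eval 2 n (rotate₁ X)) x N ⟩
    eval 2 n (rotate₁ X) + x * (1 + N) ≡⟨ cong (λ p → eval 2 n (rotate₁ X) + x * p) 2^n≡1+N ⟨
    eval 2 n (rotate₁ X) + x * 2 ^ n   ≡⟨ eval-rotate₁ 2 X ⟩
    2 * eval 2 n X + x                 ≡⟨ cong (_+ x) (+-identityʳ (2 * eval 2 n X)) ⟨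
    2 * eval 2 n X + 0 * N + x         ∎)
    where
      open ≡-Reasoning
      x : ℕ
      x = bit (X n′)
      regroup : ∀ e x N → e + x * N + x ≡ e + x * (1 + N)
      regroup e x N = solve (e ∷ x ∷ N ∷ [])

  eval₁-rotate₁ : ∀ X → eval 1 n (rotate₁ X) ≡ eval 1 n X
  eval₁-rotate₁ X = +-cancelʳ-≡ x _ _ (begin
    eval 1 n (rotate₁ X) + x         ≡⟨ cong (eval 1 n (rotate₁ X) +_)
                                          (trans (cong (x *_) (^-zeroˡ n)) (*-identityʳ x)) ⟨
    eval 1 n (rotate₁ X) + x * 1 ^ n ≡⟨ eval-rotate₁ 1 X ⟩
    1 * eval 1 n X + x               ≡⟨ cong (_+ x) (*-identityˡ (eval 1 n X)) ⟩
    eval 1 n X + x                   ∎)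
    where
      open ≡-Reasoning
      x : ℕ
      x = bit (X n′)

  eval-rotate : ∀ u X → eval 2 n (rotate u X) ≋ 2 ^ u * eval 2 n X
  eval-rotate zero    X = ≡⇒≋ (trans (eval-cong 2 n (rotate-zero X)) (sym (*-identityˡ _)))
  eval-rotate (suc u) X = begin
    eval 2 n (rotate (suc u) X)       ≡⟨ eval-cong 2 n (λ {j} _ → rotate-suc u X j) ⟩
    eval 2 n (rotate₁ (rotate u X))   ≈⟨ eval₂-rotate₁ (rotate u X) ⟩
    2 * eval 2 n (rotate u X)         ≈⟨ *-congˡ 2 (eval-rotate u X) ⟩
    2 * (2 ^ u * eval 2 n X)          ≡⟨ *-assoc 2 (2 ^ u) (eval 2 n X) ⟨
    2 ^ suc u * eval 2 n X            ∎
    where open ≋-Reasoning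

  eval₁-rotate : ∀ u X → eval 1 n (rotate u X) ≡ eval 1 n X
  eval₁-rotate zero    X = eval-cong 1 n (rotate-zero X)
  eval₁-rotate (suc u) X = begin
    eval 1 n (rotate (suc u) X)     ≡⟨ eval-cong 1 n (λ {j} _ → rotate-suc u X j) ⟩
    eval 1 n (rotate₁ (rotate u X)) ≡⟨ eval₁-rotate₁ (rotate u X) ⟩
    eval 1 n (rotate u X)           ≡⟨ eval₁-rotate u X ⟩
    eval 1 n X                      ∎
    where open ≡-Reasoning

  infix 4 _⟳[_]_
  record _⟳[_]_ (X : Bits) (u : ℕ) (Y : Bits) : Set where
    constructor rotation
    field at : ∀ {j} → j < n → X j ≡ Y ((j + u) % n)

  ≋⇒⟳ : ∀ u X Y → 2 ^ u * eval 2 n X ≋ eval 2 n Y → 0 < eval 2 n Y → eval 2 n Y < N →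
                  X ⟳[ u ] Y × eval 1 n X ≡ eval 1 n Y
  ≋⇒⟳ u X Y 2ᵘX≋Y 0<Y Y<N = rotation rotated , weights
    where
      rotate≡Y : eval 2 n (rotate u X) ≡ eval 2 n Y
      rotate≡Y = ≋⇒≡ (≤-pred (subst (eval 2 n (rotate u X) <_) 2^n≡1+N (eval-<-2^ n (rotate u X)))) 0<Y Y<N
                      (≋-trans (eval-rotate u X) 2ᵘX≋Y)
      rotate≗Y : ∀ {j} → j < n → rotate u X j ≡ Y j
      rotate≗Y = eval-injective n {rotate u X} {Y} rotate≡Y
      rotated : ∀ {j} → j < n → X j ≡ Y ((j + u) % n)
      rotated {j} j<n = trans (sym (rotate-at u X j<n)) (rotate≗Y (m%n<n (j + u) n))
      weights : eval 1 n X ≡ eval 1 n Y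
      weights = trans (sym (eval₁-rotate u X)) (eval-cong 1 n rotate≗Y)

  +-mod-≡ : ∀ {j u p} → p < n → j + u ≡ p ⊎ j + u ≡ p + n → (j + u) % n ≡ p
  +-mod-≡         p<n (inj₁ j+u≡p)   = trans (cong (_% n) j+u≡p) (m<n⇒m%n≡m p<n)
  +-mod-≡ {p = p} p<n (inj₂ j+u≡p+n) = trans (cong (_% n) j+u≡p+n) (trans ([m+n]%n≡m%n p n) (m<n⇒m%n≡m p<n))

  module _ {X Y u} (X⟳Y : X ⟳[ u ] Y) {j p} (j<n : j < n) (p<n : p < n)
           (j+u≡p : j + u ≡ p ⊎ j + u ≡ p + n) where

    ⟳-at : X j ≡ Y p
    ⟳-at = trans (_⟳[_]_.at X⟳Y j<n) (cong Y (+-mod-≡ {j} {u} p<n j+u≡p))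

    ⟳-∈ : j ∈ X → p ∈ Y
    ⟳-∈ = subst T ⟳-at

    ⟳-∉ : j ∉ X → p ∉ Y
    ⟳-∉ j∉X p∈Y = j∉X (subst T (sym ⟳-at) p∈Y)

  u+[w+n′u]≡w+un : ∀ u w → u + (w + n′ * u) ≡ w + u * suc n′
  u+[w+n′u]≡w+un u w = solve (u ∷ w ∷ n′ ∷ [])

  divide-by-2^ : ∀ c x y w v → 2 ^ c * x + 2 ^ w ≋ 2 ^ c * y + 2 ^ v →
                x + 2 ^ (w + n′ * c) ≋ y + 2 ^ (v + n′ * c)
  divide-by-2^ c x y w v h = 2^-cancel c (begin
    2 ^ c * (x + 2 ^ (w + n′ * c))        ≡⟨ *-distribˡ-+ (2 ^ c) x _ ⟩
    2 ^ c * x + 2 ^ c * 2 ^ (w + n′ * c)  ≈⟨ +-congˡ (2 ^ c * x) (2^-shift w) ⟨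
    2 ^ c * x + 2 ^ w                     ≈⟨ h ⟩
    2 ^ c * y + 2 ^ v                     ≈⟨ +-congˡ (2 ^ c * y) (2^-shift v) ⟩
    2 ^ c * y + 2 ^ c * 2 ^ (v + n′ * c)  ≡⟨ *-distribˡ-+ (2 ^ c) y _ ⟨
    2 ^ c * (y + 2 ^ (v + n′ * c))        ∎)
    where
      open ≋-Reasoning
      2^-shift : ∀ w → 2 ^ w ≋ 2 ^ c * 2 ^ (w + n′ * c)
      2^-shift w = begin
        2 ^ w                    ≈⟨ 2^-cong (c + (w + n′ * c)) w exponents ⟨
        2 ^ (c + (w + n′ * c))   ≡⟨ ^-distribˡ-+-* 2 c (w + n′ * c) ⟩
        2 ^ c * 2 ^ (w + n′ * c) ∎
        where exponents : (c + (w + n′ * c)) % n ≡ w % n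
              exponents = trans (cong (_% n) (u+[w+n′u]≡w+un c w)) ([m+kn]%n≡m%n w c n)

  reduce-exponents : ∀ x u w v → 2 ^ u * x + 2 ^ w ≋ x + 2 ^ v →
                     2 ^ (u % n) * (x + 2 ^ ((w + n′ * u) % n)) ≋ x + 2 ^ (v % n)
  reduce-exponents x u w v h = begin
    2 ^ (u % n) * (x + 2 ^ z)         ≡⟨ *-distribˡ-+ (2 ^ (u % n)) x (2 ^ z) ⟩
    2 ^ (u % n) * x + 2 ^ (u % n) * 2 ^ z ≡⟨ cong (2 ^ (u % n) * x +_) (^-distribˡ-+-* 2 (u % n) z) ⟨
    2 ^ (u % n) * x + 2 ^ (u % n + z) ≈⟨ +-cong (*-congʳ x (2^-cong (u % n) u (m%n%n≡m%n u n))) (2^-cong (u % n + z) w exponents) ⟩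
    2 ^ u * x + 2 ^ w                 ≈⟨ h ⟩
    x + 2 ^ v                         ≈⟨ +-congˡ x (2^≋2^[%n] v) ⟩
    x + 2 ^ (v % n)                   ∎
    where
      open ≋-Reasoning
      z : ℕ
      z = (w + n′ * u) % n
      exponents : (u % n + z) % n ≡ w % n
      exponents = trans (sym (%-distribˡ-+ u (w + n′ * u) n))
                        (trans (cong (_% n) (u+[w+n′u]≡w+un u w)) ([m+kn]%n≡m%n w u n))

e-telescopes : ∀ l k → 2 ^ k * e l k + 1 ≡ e l k + 2 ^ (l * k)
e-telescopes zero    k = cong (_+ 1) (*-zeroʳ (2 ^ k))
e-telescopes (suc l) k = begin
  2 ^ k * (e l k + 2 ^ (l * k)) + 1         ≡⟨ rearrange (2 ^ k) (e l k) (2 ^ (l * k)) ⟩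
  (2 ^ k * e l k + 1) + 2 ^ k * 2 ^ (l * k) ≡⟨ cong₂ _+_ (e-telescopes l k) (sym (^-distribˡ-+-* 2 k (l * k))) ⟩
  (e l k + 2 ^ (l * k)) + 2 ^ (k + l * k)   ∎
  where open ≡-Reasoning
        rearrange : ∀ p x q → p * (x + q) + 1 ≡ (p * x + 1) + p * q
        rearrange p x q = solve (p ∷ x ∷ q ∷ [])

module EvenNiho (M : ℕ) (1<M : 1 < M) where

  open Cyclic (4 * M) public

  -- Side conditions spell n out as suc (4 * M): solve treats the definition n as an opaque constant.

  M<2M : M < 2 * M
  M<2M = ≤-via 1 1<M (solve (M ∷ []))

  2M<n : 2 * M < suc (4 * M)
  2M<n = ≤-by (2 * M) (solve (M ∷ []))

  1+2M<n : 1 + 2 * M < suc (4 * M)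
  1+2M<n = ≤-via (suc M) 1<M (solve (M ∷ []))

  0<M : 0 < M
  0<M = <-trans z<s 1<M

  M<n : M < n
  M<n = <-trans M<2M 2M<n

  S : Bits
  S = below M ∪ ⁅ 2 * M ⁆

  D : ℕ
  D = eval 2 n S

  Carry : ℕ → Bits
  Carry z = below z ∪ ⁅ M ⁆ ∪ ⁅ 2 * M ⁆

  Top : Bits
  Top = below M ∪ ⁅ 1 + 2 * M ⁆

  Insert : ℕ → Bits
  Insert z = S ∪ ⁅ z ⁆

  -- The binary digits of D + 2 ^ z, according to where the carry stops.
  data Shape : Bits → Set where
    carry  : ∀ {z} → z < M → Shape (Carry z)
    top    : Shape Top
    insert : ∀ {z} → M ≤ z → z ≢ 2 * M → z < n → Shape (Insert z)

  eval-S : ∀ b → eval b n S ≡ geo b M + b ^ (2 * M)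
  eval-S b = trans (eval-∪ b n (below M) ⁅ 2 * M ⁆ (below-⁅⁆-disjoint (<⇒≤ M<2M)))
                   (cong₂ _+_ (eval-below b n (<⇒≤ M<n)) (eval-⁅⁆ b n 2M<n))

  eval-Carry : ∀ b {z} → z < M → eval b n (Carry z) ≡ geo b z + (b ^ M + b ^ (2 * M))
  eval-Carry b {z} z<M = begin
    eval b n (Carry z)                                  ≡⟨ eval-∪ b n (below z) (⁅ M ⁆ ∪ ⁅ 2 * M ⁆) (∪-disjointʳ (below-⁅⁆-disjoint (<⇒≤ z<M))
                                                             (below-⁅⁆-disjoint (<⇒≤ (<-trans z<M M<2M)))) ⟩
    eval b n (below z) + eval b n (⁅ M ⁆ ∪ ⁅ 2 * M ⁆)   ≡⟨ cong₂ _+_ (eval-below b n (<⇒≤ (<-trans z<M M<n)))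
                                                             (eval-∪ b n ⁅ M ⁆ ⁅ 2 * M ⁆ (⁅⁆-disjoint (<⇒≢ M<2M))) ⟩
    geo b z + (eval b n ⁅ M ⁆ + eval b n ⁅ 2 * M ⁆)     ≡⟨ cong (geo b z +_) (cong₂ _+_ (eval-⁅⁆ b n M<n) (eval-⁅⁆ b n 2M<n)) ⟩
    geo b z + (b ^ M + b ^ (2 * M))                     ∎
    where open ≡-Reasoning

  eval-Top : ∀ b → eval b n Top ≡ geo b M + b ^ (1 + 2 * M)
  eval-Top b = trans (eval-∪ b n (below M) ⁅ 1 + 2 * M ⁆ (below-⁅⁆-disjoint (<⇒≤ (m<n⇒m<1+n M<2M))))
                     (cong₂ _+_ (eval-below b n (<⇒≤ M<n)) (eval-⁅⁆ b n 1+2M<n))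

  eval-Insert : ∀ b {z} → M ≤ z → z ≢ 2 * M → z < n → eval b n (Insert z) ≡ eval b n S + b ^ z
  eval-Insert b {z} M≤z z≢2M z<n = trans (eval-∪ b n S ⁅ z ⁆ (∪-disjointˡ {below M} (below-⁅⁆-disjoint M≤z) (⁅⁆-disjoint (z≢2M ∘ sym))))
                                     (cong (eval b n S +_) (eval-⁅⁆ b n z<n))

  weight-Carry : ∀ {z} → z < M → eval 1 n (Carry z) ≡ 2 + z
  weight-Carry {z} z<M = begin
    eval 1 n (Carry z)              ≡⟨ eval-Carry 1 z<M ⟩
    geo 1 z + (1 ^ M + 1 ^ (2 * M)) ≡⟨ cong₂ (λ a b → a + (b + 1 ^ (2 * M))) (geo-1 z) (^-zeroˡ M) ⟩
    z + (1 + 1 ^ (2 * M))           ≡⟨ cong (λ a → z + suc a) (^-zeroˡ (2 * M)) ⟩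
    z + 2                           ≡⟨ +-comm z 2 ⟩
    2 + z                           ∎
    where open ≡-Reasoning

  weight-Top : eval 1 n Top ≡ 1 + M
  weight-Top = trans (eval-Top 1) (trans (cong₂ _+_ (geo-1 M) (^-zeroˡ (1 + 2 * M))) (+-comm M 1))

  weight-Insert : ∀ {z} → M ≤ z → z ≢ 2 * M → z < n → eval 1 n (Insert z) ≡ 2 + M
  weight-Insert {z} M≤z z≢2M z<n = begin
    eval 1 n (Insert z)           ≡⟨ eval-Insert 1 M≤z z≢2M z<n ⟩
    eval 1 n S + 1 ^ z            ≡⟨ cong₂ _+_ (eval-S 1) (^-zeroˡ z) ⟩
    geo 1 M + 1 ^ (2 * M) + 1     ≡⟨ cong₂ (λ a b → a + b + 1) (geo-1 M) (^-zeroˡ (2 * M)) ⟩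
    M + 1 + 1                     ≡⟨ solve (M ∷ []) ⟩
    2 + M                         ∎
    where open ≡-Reasoning

  digits-of-D+2^ : ∀ {z} → z < n → ∃[ X ] Shape X × eval 2 n X ≡ D + 2 ^ z
  digits-of-D+2^ {z} z<n with z <? M | z ≟ 2 * M
  ... | yes z<M | _ = Carry z , carry z<M , (begin
    eval 2 n (Carry z)                   ≡⟨ eval-Carry 2 z<M ⟩
    geo 2 z + (2 ^ M + 2 ^ (2 * M))       ≡⟨ cong (λ p → geo 2 z + (p + 2 ^ (2 * M))) (geo-2 M) ⟨
    geo 2 z + (geo 2 M + 1 + 2 ^ (2 * M)) ≡⟨ rearrange (geo 2 z) (geo 2 M) (2 ^ (2 * M)) ⟩
    geo 2 M + 2 ^ (2 * M) + (geo 2 z + 1) ≡⟨ cong₂ _+_ (eval-S 2) (sym (geo-2 z)) ⟨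
    D + 2 ^ z                             ∎)
    where open ≡-Reasoning
          rearrange : ∀ a b c → a + (b + 1 + c) ≡ b + c + (a + 1)
          rearrange a b c = solve (a ∷ b ∷ c ∷ [])
  ... | no z≮M | yes refl = Top , top , (begin
    eval 2 n Top                         ≡⟨ eval-Top 2 ⟩
    geo 2 M + 2 ^ (1 + 2 * M)            ≡⟨ rearrange (geo 2 M) (2 ^ (2 * M)) ⟩
    geo 2 M + 2 ^ (2 * M) + 2 ^ (2 * M)  ≡⟨ cong (_+ 2 ^ (2 * M)) (eval-S 2) ⟨
    D + 2 ^ (2 * M)                      ∎)
    where open ≡-Reasoning
          rearrange : ∀ a b → a + 2 * b ≡ a + b + b
          rearrange a b = solve (a ∷ b ∷ [])
  ... | no z≮M | no z≢2M = Insert z , insert (≮⇒≥ z≮M) z≢2M z<n , eval-Insert 2 (≮⇒≥ z≮M) z≢2M z<n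

  ∈S : ∀ {j} → j < M → j ∈ S
  ∈S {j} j<M = ∈-∪ˡ {j} {below M} ⁅ 2 * M ⁆ (∈-below j<M)

  2M∈S : 2 * M ∈ S
  2M∈S = ∈-∪ʳ {2 * M} (below M) {⁅ 2 * M ⁆} (∈-⁅⁆ {2 * M})

  ∉S : ∀ {p} → M ≤ p → p ≢ 2 * M → p ∉ S
  ∉S {p} M≤p p≢2M = ∉-∪ {p} {below M} {⁅ 2 * M ⁆} (∉-below M≤p) (∉-⁅⁆ p≢2M)

  M∈Carry : ∀ z → M ∈ Carry z
  M∈Carry z = ∈-∪ʳ {M} (below z) {⁅ M ⁆ ∪ ⁅ 2 * M ⁆} (∈-∪ˡ {M} {⁅ M ⁆} ⁅ 2 * M ⁆ (∈-⁅⁆ {M}))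

  2M∈Carry : ∀ z → 2 * M ∈ Carry z
  2M∈Carry z = ∈-∪ʳ {2 * M} (below z) {⁅ M ⁆ ∪ ⁅ 2 * M ⁆} (∈-∪ʳ {2 * M} ⁅ M ⁆ {⁅ 2 * M ⁆} (∈-⁅⁆ {2 * M}))

  ∉Carry : ∀ {z p} → z < M → 2 * M < p → p ∉ Carry z
  ∉Carry {z} {p} z<M 2M<p = ∉-∪ {p} {below z} {⁅ M ⁆ ∪ ⁅ 2 * M ⁆} (∉-below (<⇒≤ (<-trans z<M M<p)))
                              (∉-∪ {p} {⁅ M ⁆} {⁅ 2 * M ⁆} (∉-⁅⁆ (>⇒≢ M<p)) (∉-⁅⁆ (>⇒≢ 2M<p)))
    where M<p : M < p
          M<p = <-trans M<2M 2M<p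

  ∈Top : ∀ {j} → j < M → j ∈ Top
  ∈Top {j} j<M = ∈-∪ˡ {j} {below M} ⁅ 1 + 2 * M ⁆ (∈-below j<M)

  1+2M∈Top : 1 + 2 * M ∈ Top
  1+2M∈Top = ∈-∪ʳ {1 + 2 * M} (below M) {⁅ 1 + 2 * M ⁆} (∈-⁅⁆ {1 + 2 * M})

  ∉Top : ∀ {p} → M ≤ p → p ≢ 1 + 2 * M → p ∉ Top
  ∉Top {p} M≤p p≢1+2M = ∉-∪ {p} {below M} {⁅ 1 + 2 * M ⁆} (∉-below M≤p) (∉-⁅⁆ p≢1+2M)

  Insert-exit : ∀ {z₁ z₂ u j p} → Insert z₁ ⟳[ u ] Insert z₂ →
                j < n → p < n → j + u ≡ p ⊎ j + u ≡ p + n → j ∈ S → p ∉ S → p ≡ z₂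
  Insert-exit {z₁} {z₂} {j = j} {p} rot j<n p<n j+u≡p j∈S p∉S
    with ∈-∪⁻ {p} S ⁅ z₂ ⁆ (⟳-∈ rot j<n p<n j+u≡p (∈-∪ˡ {j} {S} ⁅ z₁ ⁆ j∈S))
  ... | inj₁ p∈S  = ⊥-elim (p∉S p∈S)
  ... | inj₂ p∈z₂ = ∈-⁅⁆⁻ p∈z₂

  Carry-rigid : ∀ {z₁ z₂ u} → z₁ < M → z₂ < M → 0 < u → u < n → ¬ Carry z₁ ⟳[ u ] Carry z₂
  Carry-rigid {z₁} {z₂} {u} z₁<M z₂<M 0<u u<n rot with u ≤? 2 * M
  ... | yes u≤2M = ∉Carry z₂<M 2M<2M+u (⟳-∈ rot 2M<n 2M+u<n (inj₁ refl) (2M∈Carry z₁))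
    where
      2M+u<n : 2 * M + u < suc (4 * M)
      2M+u<n = ≤-via 0 u≤2M (solve (M ∷ u ∷ []))
      2M<2M+u : 2 * M < 2 * M + u
      2M<2M+u = ≤-via 0 0<u (solve (M ∷ u ∷ []))
  ... | no u≰2M with s , u+s≡4M ← m≤n⇒∃[o]m+o≡n (≤-pred u<n) =
    ⟳-∉ rot j<n 2M<n (inj₂ j+u≡2M+n) (∉Carry z₁<M 2M<j) (2M∈Carry z₂)
    where
      j<n : suc (2 * M + s) < suc (4 * M)
      j<n = ≤-via 0 (+-mono-≤ (≰⇒> u≰2M) (≤-reflexive u+s≡4M)) (solve (M ∷ u ∷ s ∷ []))
      j+u≡2M+n : suc (2 * M + s) + u ≡ 2 * M + suc (4 * M)
      j+u≡2M+n = ≡-via u+s≡4M (solve (M ∷ u ∷ s ∷ []))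
      2M<j : 2 * M < suc (2 * M + s)
      2M<j = s≤s (m≤m+n (2 * M) s)

  Top-rigid : ∀ {u} → 0 < u → u < n → ¬ Top ⟳[ u ] Top
  Top-rigid {u} 0<u u<n rot with u <? 2 * M | u ≟ 1 + 2 * M
  ... | yes u<2M | _ = ∉Top M≤p (>⇒≢ 1+2M<p) (⟳-∈ rot 1+2M<n p<n (inj₁ refl) 1+2M∈Top)
    where
      p<n : 1 + 2 * M + u < suc (4 * M)
      p<n = ≤-via 0 u<2M (solve (M ∷ u ∷ []))
      1+2M<p : 1 + 2 * M < 1 + 2 * M + u
      1+2M<p = ≤-via 0 0<u (solve (M ∷ u ∷ []))
      M≤p : M ≤ 1 + 2 * M + u
      M≤p = ≤-by (suc (M + u)) (solve (M ∷ u ∷ []))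
  ... | no _ | yes refl = ∉Top M≤p (>⇒≢ (n<1+n (1 + 2 * M))) (⟳-∈ rot (<-trans 1<M M<n) p<n (inj₁ refl) (∈Top 1<M))
    where
      p<n : 1 + (1 + 2 * M) < suc (4 * M)
      p<n = ≤-via M 1<M (solve (M ∷ []))
      M≤p : M ≤ 1 + (1 + 2 * M)
      M≤p = ≤-by (2 + M) (solve (M ∷ []))
  ... | no u≮2M | no u≢1+2M = ∉Top (≤-trans (<⇒≤ M<2M) (≮⇒≥ u≮2M)) u≢1+2M (⟳-∈ rot z<s u<n (inj₁ refl) (∈Top 0<M))

  Top-Carry : ∀ {z u} → z < M → u < n → ¬ Top ⟳[ u ] Carry z
  Top-Carry {u = u} z<M u<n rot with <-cmp u (2 * M)
  ... | tri< u<2M _ _ = ∉Carry z<M (s≤s (m≤m+n (2 * M) u)) (⟳-∈ rot 1+2M<n p<n (inj₁ refl) 1+2M∈Top)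
    where
      p<n : 1 + 2 * M + u < suc (4 * M)
      p<n = ≤-via 0 u<2M (solve (M ∷ u ∷ []))
  ... | tri≈ _ refl _ = ∉Carry z<M (n<1+n (2 * M)) (⟳-∈ rot (<-trans 1<M M<n) 1+2M<n (inj₁ refl) (∈Top 1<M))
  ... | tri> _ _ 2M<u = ∉Carry z<M 2M<u (⟳-∈ rot z<s u<n (inj₁ refl) (∈Top 0<M))

  Carry-Top : ∀ {z u} → u < n → ¬ Carry z ⟳[ u ] Top
  Carry-Top {z} {u} u<n rot with u ≤? 3 * M | u ≟ suc M
  ... | yes u≤3M | no u≢1+M = ∉Top (m≤m+n M u) p≢1+2M (⟳-∈ rot M<n p<n (inj₁ refl) (M∈Carry z))
    where
      p<n : M + u < suc (4 * M)
      p<n = ≤-via 0 u≤3M (solve (M ∷ u ∷ []))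
      p≢1+2M : M + u ≢ 1 + 2 * M
      p≢1+2M p≡1+2M = u≢1+M (≡-via p≡1+2M (solve (M ∷ u ∷ [])))
  ... | yes _ | yes refl = ∉Top M≤p (>⇒≢ 1+2M<p) (⟳-∈ rot 2M<n p<n (inj₁ refl) (2M∈Carry z))
    where
      p<n : 2 * M + suc M < suc (4 * M)
      p<n = ≤-via 1 1<M (solve (M ∷ []))
      M≤p : M ≤ 2 * M + suc M
      M≤p = ≤-by (suc (2 * M)) (solve (M ∷ []))
      1+2M<p : 1 + 2 * M < 2 * M + suc M
      1+2M<p = ≤-via 1 1<M (solve (M ∷ []))
  ... | no u≰3M | _ with r , refl ← m≤n⇒∃[o]m+o≡n (≰⇒> u≰3M) =
    ∉Top (m≤m+n M r) (<⇒≢ p<1+2M) (⟳-∈ rot 2M<n p<n (inj₂ j+u≡p+n) (2M∈Carry z))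
    where
      r<M : r < M
      r<M = ≤-via 0 u<n (solve (M ∷ r ∷ []))
      p<n : M + r < suc (4 * M)
      p<n = ≤-via (suc (2 * M)) r<M (solve (M ∷ r ∷ []))
      p<1+2M : M + r < 1 + 2 * M
      p<1+2M = ≤-via 1 r<M (solve (M ∷ r ∷ []))
      j+u≡p+n : 2 * M + (suc (3 * M) + r) ≡ M + r + suc (4 * M)
      j+u≡p+n = solve (M ∷ r ∷ [])

  -- Each case finds two digits of S that the rotation moves off S; by Insert-exit both would be z₂.
  Insert-rigid-<2M : ∀ {z₁ z₂ u} → 0 < u → u < 2 * M → ¬ Insert z₁ ⟳[ u ] Insert z₂
  Insert-rigid-<2M {u = u} 0<u u<2M rot with u ≤? M
  ... | yes u≤M with s , u+s≡M ← m≤n⇒∃[o]m+o≡n u≤M = <⇒≢ M<p (trans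
    (Insert-exit rot s<n M<n (inj₁ (trans (+-comm s u) u+s≡M)) (∈S s<M) (∉S ≤-refl (<⇒≢ M<2M)))
    (sym (Insert-exit rot 2M<n p<n (inj₁ refl) 2M∈S (∉S (<⇒≤ M<p) (>⇒≢ 2M<p)))))
    where
      s<M : s < M
      s<M = ≤-via 0 (+-mono-≤ 0<u (≤-reflexive u+s≡M)) (solve (M ∷ u ∷ s ∷ []))
      s<n : s < n
      s<n = <-trans s<M M<n
      p<n : 2 * M + u < suc (4 * M)
      p<n = ≤-via M u≤M (solve (M ∷ u ∷ []))
      2M<p : 2 * M < 2 * M + u
      2M<p = ≤-via 0 0<u (solve (M ∷ u ∷ []))
      M<p : M < 2 * M + u
      M<p = <-trans M<2M 2M<p
  ... | no u≰M = <⇒≢ (m<n+m u 0<2M) (trans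
    (Insert-exit rot z<s u<n (inj₁ refl) (∈S 0<M) (∉S (<⇒≤ (≰⇒> u≰M)) (<⇒≢ u<2M)))
    (sym (Insert-exit rot 2M<n p<n (inj₁ refl) 2M∈S (∉S (<⇒≤ (<-trans M<2M 2M<p)) (>⇒≢ 2M<p)))))
    where
      0<2M : 0 < 2 * M
      0<2M = <-trans 0<M M<2M
      u<n : u < n
      u<n = <-trans u<2M 2M<n
      p<n : 2 * M + u < suc (4 * M)
      p<n = ≤-via 1 u<2M (solve (M ∷ u ∷ []))
      2M<p : 2 * M < 2 * M + u
      2M<p = ≤-via 0 0<u (solve (M ∷ u ∷ []))

  Insert-rigid-2M : ∀ {z₁ z₂} → ¬ Insert z₁ ⟳[ 2 * M ] Insert z₂
  Insert-rigid-2M rot = <⇒≢ 1+2M<4M (trans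
    (Insert-exit rot (<-trans 1<M M<n) 1+2M<n (inj₁ refl) (∈S 1<M) (∉S M≤1+2M (>⇒≢ (n<1+n (2 * M)))))
    (sym (Insert-exit rot 2M<n 4M<n (inj₁ refl) 2M∈S (∉S M≤4M (>⇒≢ 2M<4M)))))
    where
      4M<n : 2 * M + 2 * M < suc (4 * M)
      4M<n = ≤-by 0 (solve (M ∷ []))
      M≤1+2M : M ≤ 1 + 2 * M
      M≤1+2M = ≤-by (suc M) (solve (M ∷ []))
      M≤4M : M ≤ 2 * M + 2 * M
      M≤4M = ≤-by (3 * M) (solve (M ∷ []))
      2M<4M : 2 * M < 2 * M + 2 * M
      2M<4M = ≤-via (suc M) 1<M (solve (M ∷ []))
      1+2M<4M : 1 + 2 * M < 2 * M + 2 * M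
      1+2M<4M = ≤-via M 1<M (solve (M ∷ []))

  Insert-rigid->2M : ∀ {z₁ z₂ u} → 2 * M < u → u < n → ¬ Insert z₁ ⟳[ u ] Insert z₂
  Insert-rigid->2M {u = u} 2M<u u<n rot with u ≤? 3 * M
  ... | yes u≤3M = <⇒≢ (n<1+n u) (trans
    (Insert-exit rot z<s u<n (inj₁ refl) (∈S 0<M) (∉S (<⇒≤ M<u) (>⇒≢ 2M<u)))
    (sym (Insert-exit rot (<-trans 1<M M<n) p<n (inj₁ refl) (∈S 1<M) (∉S (<⇒≤ (<-trans M<u (n<1+n u))) (>⇒≢ (<-trans 2M<u (n<1+n u)))))))
    where
      M<u : M < u
      M<u = <-trans M<2M 2M<u
      p<n : 1 + u < suc (4 * M)
      p<n = ≤-via 1 (+-mono-≤ u≤3M 1<M) (solve (M ∷ u ∷ []))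
  ... | no u≰3M with r , refl ← m≤n⇒∃[o]m+o≡n (≰⇒> u≰3M) = >⇒≢ p<u (trans
    (Insert-exit rot z<s u<n (inj₁ refl) (∈S 0<M) (∉S (<⇒≤ (<-trans M<2M 2M<u)) (>⇒≢ 2M<u)))
    (sym (Insert-exit rot 2M<n p<n (inj₂ j+u≡p+n) 2M∈S (∉S (m≤m+n M r) (<⇒≢ p<2M)))))
    where
      r<M : r < M
      r<M = ≤-via 0 u<n (solve (M ∷ r ∷ []))
      p<2M : M + r < 2 * M
      p<2M = ≤-via 0 r<M (solve (M ∷ r ∷ []))
      p<n = <-trans p<2M 2M<n
      p<u : M + r < suc (3 * M) + r
      p<u = ≤-by (2 * M) (solve (M ∷ r ∷ []))
      j+u≡p+n : 2 * M + (suc (3 * M) + r) ≡ M + r + suc (4 * M)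
      j+u≡p+n = solve (M ∷ r ∷ [])

  Insert-rigid : ∀ {z₁ z₂ u} → 0 < u → u < n → ¬ Insert z₁ ⟳[ u ] Insert z₂
  Insert-rigid {u = u} 0<u u<n with <-cmp u (2 * M)
  ... | tri< u<2M _ _ = Insert-rigid-<2M 0<u u<2M
  ... | tri≈ _ refl _ = Insert-rigid-2M
  ... | tri> _ _ 2M<u = Insert-rigid->2M 2M<u u<n

  Shape-rigid : ∀ {X Y u} → Shape X → Shape Y → 0 < u → u < n →
                X ⟳[ u ] Y → eval 1 n X ≡ eval 1 n Y → ⊥
  Shape-rigid (carry z₁<M) (carry z₂<M) 0<u u<n rot _ = Carry-rigid z₁<M z₂<M 0<u u<n rot
  Shape-rigid (carry {z} _) top         _   u<n rot _ = Carry-Top {z} u<n rot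
  Shape-rigid top          (carry z<M)  _   u<n rot _ = Top-Carry z<M u<n rot
  Shape-rigid top          top          0<u u<n rot _ = Top-rigid 0<u u<n rot
  Shape-rigid (insert _ _ _) (insert _ _ _) 0<u u<n rot _ = Insert-rigid 0<u u<n rot
  Shape-rigid (carry z<M) (insert M≤z z≢2M z<n) _ _ _ same = <⇒≢ z<M
    (+-cancelˡ-≡ 2 _ _ (trans (sym (weight-Carry z<M)) (trans same (weight-Insert M≤z z≢2M z<n))))
  Shape-rigid (insert M≤z z≢2M z<n) (carry z<M) _ _ _ same = <⇒≢ z<M
    (+-cancelˡ-≡ 2 _ _ (trans (sym (weight-Carry z<M)) (trans (sym same) (weight-Insert M≤z z≢2M z<n))))
  Shape-rigid top (insert M≤z z≢2M z<n) _ _ _ same =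
    1+n≢n (sym (trans (sym weight-Top) (trans same (weight-Insert M≤z z≢2M z<n))))
  Shape-rigid (insert M≤z z≢2M z<n) top _ _ _ same =
    1+n≢n (sym (trans (sym weight-Top) (trans (sym same) (weight-Insert M≤z z≢2M z<n))))

  D+2^v<N : ∀ {v} → v < n → D + 2 ^ v < N
  D+2^v<N {v} v<n = ≤-pred (subst (2 + (D + 2 ^ v) ≤_) 2^n≡1+N (begin
    2 + (D + 2 ^ v)                         ≡⟨ cong (λ d → 2 + (d + 2 ^ v)) (eval-S 2) ⟩
    2 + (geo 2 M + 2 ^ (2 * M) + 2 ^ v)     ≡⟨ rearrange (geo 2 M) (2 ^ (2 * M)) (2 ^ v) ⟩
    (geo 2 M + 1) + 1 + 2 ^ (2 * M) + 2 ^ v ≡⟨ cong (λ p → p + 1 + 2 ^ (2 * M) + 2 ^ v) (geo-2 M) ⟩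
    2 ^ M + 1 + 2 ^ (2 * M) + 2 ^ v         ≤⟨ +-monoˡ-≤ (2 ^ v) (+-monoˡ-≤ (2 ^ (2 * M)) 2^M+1≤2^2M) ⟩
    2 ^ (2 * M) + 2 ^ (2 * M) + 2 ^ v       ≡⟨ cong (_+ 2 ^ v) (2^m+2^m≡2^[1+m] (2 * M)) ⟩
    2 ^ (1 + 2 * M) + 2 ^ v                 ≤⟨ +-mono-≤ (^-monoʳ-≤ 2 1+2M≤4M) (^-monoʳ-≤ 2 (≤-pred v<n)) ⟩
    2 ^ (4 * M) + 2 ^ (4 * M)               ≡⟨ 2^m+2^m≡2^[1+m] (4 * M) ⟩
    2 ^ n                                   ∎))
    where
      open ≤-Reasoning
      rearrange : ∀ g q p → 2 + (g + q + p) ≡ g + 1 + 1 + q + p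
      rearrange g q p = solve (g ∷ q ∷ p ∷ [])
      2^m+2^m≡2^[1+m] : ∀ m → 2 ^ m + 2 ^ m ≡ 2 ^ (1 + m)
      2^m+2^m≡2^[1+m] m = cong (2 ^ m +_) (sym (+-identityʳ (2 ^ m)))
      1+2M≤4M : 1 + 2 * M ≤ 4 * M
      1+2M≤4M = ≤-via (suc M) 1<M (solve (M ∷ []))
      2^M+1≤2^2M : 2 ^ M + 1 ≤ 2 ^ (2 * M)
      2^M+1≤2^2M = begin
        2 ^ M + 1     ≤⟨ +-monoʳ-≤ (2 ^ M) (m^n>0 2 M) ⟩
        2 ^ M + 2 ^ M ≡⟨ 2^m+2^m≡2^[1+m] M ⟩
        2 ^ (1 + M)   ≤⟨ ^-monoʳ-≤ 2 1+M≤2M ⟩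
        2 ^ (2 * M)   ∎
        where 1+M≤2M : 1 + M ≤ 2 * M
              1+M≤2M = ≤-via 1 1<M (solve (M ∷ []))

  no-rotation : ∀ {u z v} → 0 < u → u < n → z < n → v < n → ¬ 2 ^ u * (D + 2 ^ z) ≋ D + 2 ^ v
  no-rotation {u} {z} {v} 0<u u<n z<n v<n 2ᵘ[D+2ᶻ]≋D+2ᵛ
    with X , shape-X , X≡ ← digits-of-D+2^ z<n | Y , shape-Y , Y≡ ← digits-of-D+2^ v<n =
    Shape-rigid shape-X shape-Y 0<u u<n (proj₁ rotated) (proj₂ rotated)
    where
      2ᵘX≋Y : 2 ^ u * eval 2 n X ≋ eval 2 n Y
      2ᵘX≋Y = subst₂ (λ x y → 2 ^ u * x ≋ y) (sym X≡) (sym Y≡) 2ᵘ[D+2ᶻ]≋D+2ᵛ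
      0<Y : 0 < eval 2 n Y
      0<Y = subst (0 <_) (sym Y≡) (≤-trans (m^n>0 2 v) (m≤n+m (2 ^ v) D))
      Y<N : eval 2 n Y < N
      Y<N = subst (_< N) (sym Y≡) (D+2^v<N v<n)
      rotated : X ⟳[ u ] Y × eval 1 n X ≡ eval 1 n Y
      rotated = ≋⇒⟳ u X Y 2ᵘX≋Y 0<Y Y<N

  no-power-relation : ∀ u w v → ¬ n ∣ u → ¬ 2 ^ u * D + 2 ^ w ≋ D + 2 ^ v
  no-power-relation u w v n∤u h =
    no-rotation 0<u%n (m%n<n u n) (m%n<n (w + 4 * M * u) n) (m%n<n v n) (reduce-exponents D u w v h)
    where 0<u%n : 0 < u % n
          0<u%n = n≢0⇒n>0 (λ u%n≡0 → n∤u (m%n≡0⇒n∣m u n u%n≡0))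

  no-equivalence-by-shift : ∀ i → gcd i n ≡ 1 → ∀ a → ¬ 2 ^ a * D ≋ e (suc M) i
  no-equivalence-by-shift i gcd≡1 a 2ᵃD≋E = no-power-relation i (0 + 4 * M * a) (suc M * i + 4 * M * a) n∤i
    (divide-by-2^ a (2 ^ i * D) D 0 (suc M * i) (begin
      2 ^ a * (2 ^ i * D) + 1     ≡⟨ cong (_+ 1) (x∙yz≈y∙xz (2 ^ a) (2 ^ i) D) ⟩
      2 ^ i * (2 ^ a * D) + 1     ≈⟨ +-congʳ 1 (*-congˡ (2 ^ i) 2ᵃD≋E) ⟩
      2 ^ i * E + 1               ≡⟨ e-telescopes (suc M) i ⟩
      E + 2 ^ (suc M * i)         ≈⟨ +-congʳ (2 ^ (suc M * i)) (≋-sym 2ᵃD≋E) ⟩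
      2 ^ a * D + 2 ^ (suc M * i) ∎))
    where
      open ≋-Reasoning
      E : ℕ
      E = e (suc M) i
      n∤i : ¬ n ∣ i
      n∤i n∣i = <⇒≢ (<-trans 1<M M<n) (sym (∣1⇒≡1 (subst (n ∣_) gcd≡1 (gcd-greatest n∣i ∣-refl))))

  no-equivalence-by-inverse : ∀ i → gcd i n ≡ 1 → ∀ d → D * d ≋ 1 → ∀ a → ¬ 2 ^ a * d ≋ e (suc M) i
  no-equivalence-by-inverse i gcd≡1 d Dd≋1 a 2ᵃd≋E = no-power-relation (suc M * i) a (i + a) n∤[1+M]i (begin
    Q * D + 2 ^ a         ≈⟨ +-congˡ (Q * D) DE≋2ᵃ ⟨
    Q * D + D * E         ≡⟨ factor Q D E ⟩
    D * (E + Q)           ≡⟨ cong (D *_) (e-telescopes (suc M) i) ⟨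
    D * (2 ^ i * E + 1)   ≡⟨ expand D (2 ^ i) E ⟩
    2 ^ i * (D * E) + D   ≈⟨ +-congʳ D (*-congˡ (2 ^ i) DE≋2ᵃ) ⟩
    2 ^ i * 2 ^ a + D     ≡⟨ trans (cong (D +_) (^-distribˡ-+-* 2 i a)) (+-comm D (2 ^ i * 2 ^ a)) ⟨
    D + 2 ^ (i + a)       ∎)
    where
      open ≋-Reasoning
      E : ℕ
      E = e (suc M) i
      Q : ℕ
      Q = 2 ^ (suc M * i)
      factor : ∀ q d x → q * d + d * x ≡ d * (x + q)
      factor q d x = solve (q ∷ d ∷ x ∷ [])
      expand : ∀ d p x → d * (p * x + 1) ≡ p * (d * x) + d
      expand d p x = solve (d ∷ p ∷ x ∷ [])
      DE≋2ᵃ : D * E ≋ 2 ^ a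
      DE≋2ᵃ = begin
        D * E           ≈⟨ *-congˡ D 2ᵃd≋E ⟨
        D * (2 ^ a * d) ≡⟨ x∙yz≈y∙xz D (2 ^ a) d ⟩
        2 ^ a * (D * d) ≈⟨ *-congˡ (2 ^ a) Dd≋1 ⟩
        2 ^ a * 1       ≡⟨ *-identityʳ (2 ^ a) ⟩
        2 ^ a           ∎
      n∤[1+M]i : ¬ n ∣ suc M * i
      n∤[1+M]i n∣[1+M]i = <⇒≱ 1+M<n (∣⇒≤ (coprime-divisor coprime (subst (n ∣_) (*-comm (suc M) i) n∣[1+M]i)))
        where coprime : Coprimality.Coprime n i
              coprime = Coprimality.sym {i} {n} (gcd≡1⇒coprime {i} {n} gcd≡1)
              1+M<n : suc M < suc (4 * M)
              1+M<n = ≤-via (suc (2 * M)) 1<M (solve (M ∷ []))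

  not-cyclotomic-equivalent : ∀ i → gcd i n ≡ 1 → ¬ CycEquiv n D (e (suc M) i)
  not-cyclotomic-equivalent i gcd≡1 (inj₁ (a , 2ᵃD≋E))                  = no-equivalence-by-shift i gcd≡1 a 2ᵃD≋E
  not-cyclotomic-equivalent i gcd≡1 (inj₂ (_ , d , Dd≋1 , a , 2ᵃd≋E)) = no-equivalence-by-inverse i gcd≡1 d Dd≋1 a 2ᵃd≋E

  closed-form : 2 ^ (M * 2) + 2 ^ (M * 2 / 2) ∸ 1 ≡ D
  closed-form = begin
    2 ^ (M * 2) + 2 ^ (M * 2 / 2) ∸ 1 ≡⟨ cong₂ (λ x y → 2 ^ x + 2 ^ y ∸ 1) (*-comm M 2) (m*n/n≡m M 2) ⟩
    2 ^ (2 * M) + 2 ^ M ∸ 1           ≡⟨ cong (λ y → 2 ^ (2 * M) + y ∸ 1) (geo-2 M) ⟨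
    2 ^ (2 * M) + (geo 2 M + 1) ∸ 1   ≡⟨ cong (_∸ 1) (+-assoc (2 ^ (2 * M)) (geo 2 M) 1) ⟨
    2 ^ (2 * M) + geo 2 M + 1 ∸ 1     ≡⟨ m+n∸n≡m (2 ^ (2 * M) + geo 2 M) 1 ⟩
    2 ^ (2 * M) + geo 2 M             ≡⟨ +-comm (2 ^ (2 * M)) (geo 2 M) ⟩
    geo 2 M + 2 ^ (2 * M)             ≡⟨ eval-S 2 ⟨
    D                                 ∎
    where open ≡-Reasoning

2*[M*2]+1≡1+4M : ∀ M → 2 * (M * 2) + 1 ≡ suc (4 * M)
2*[M*2]+1≡1+4M M = solve (M ∷ [])

[M*2+2]/2≡1+M : ∀ M → (M * 2 + 2) / 2 ≡ suc M
[M*2+2]/2≡1+M M = trans (cong (_/ 2) (+-comm (M * 2) 2)) (m*n/n≡m (suc M) 2)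

theorem6 : (t i : ℕ) → 2 < t → 2 ∣ t → gcd i (2 * t + 1) ≡ 1 →
    ¬ CycEquiv (2 * t + 1) (2 ^ t + 2 ^ (t / 2) ∸ 1) (e ((t + 2) / 2) i)
theorem6 .(M * 2) i 2<t (divides M refl) gcd≡1
  rewrite 2*[M*2]+1≡1+4M M | EvenNiho.closed-form M (*-cancelʳ-< 2 1 M 2<t) | [M*2+2]/2≡1+M M =
  EvenNiho.not-cyclotomic-equivalent M (*-cancelʳ-< 2 1 M 2<t) i gcd≡1
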